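{- Let $G=(A_G,B_G,\lambda_G)$ and $H=(A_H,B_H,\lambda_H)$ be temporal bi-cliques with $|A_G|=|B_G|=n_G$ and $|A_H|=|B_H|=n_H$, and let $S_G$ and $S_H$ be bi-spanners of $G$ and $H$, respectively. Then the product graph $G\times H$ has a bi-spanner of size at most $|S_G|\,n_H+|S_H|\,n_G$.
   Context: A temporal bi-clique $(A,B,\lambda)$ is the complete bipartite graph with disjoint parts $A,B$ with an edge labeling $\lambda$ into $\mathbb{N}$. A path $v_1\dots v_k$ is temporal if $\lambda(\{v_i,v_{i+1}\})\le\lambda(\{v_{i+1},v_{i+2}\})$ for all $i\in[k-2]$. A bi-spanner is an edge set $S$ such that every $a\in A$ reaches every $b\in B$ by a temporal path using only edges of $S$. The product graph $G\times H=(\mathcal{A},\mathcal{B},\Lambda)$ has $\mathcal{A}=A_G\times A_H$, $\mathcal{B}=B_G\times B_H$, and $\Lambda(\{(a_G,a_H),(b_G,b_H)\})=(\lambda_G(\{a_G,b_G\}),\lambda_H(\{a_H,b_H\}))\in\mathbb{N}^2$, where labels are compared lexicographically (equivalently, via an order-preserving embedding of $\mathbb{N}^2$ with the lexicographic order into $\mathbb{N}$). -}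

module Defs where

open import Data.Nat using (ℕ; _≤_; _<_)
open import Data.Fin using (Fin)
open import Data.Product using (_×_; _,_; ∃-syntax)
open import Data.Sum using (_⊎_; inj₁; inj₂)
open import Data.List using (List; []; _∷_; [_]; length)
open import Data.List.Membership.Propositional using (_∈_)
open import Data.List.Relation.Unary.All using (All)
open import Data.List.Relation.Unary.Linked using (Linked)
open import Data.List.Relation.Unary.Unique.Propositional using (Unique)
open import Relation.Binary.PropositionalEquality using (_≡_)

-- A temporal bi-clique with parts A and B (disjoint: vertices are A ⊎ B)
-- is given by its edge labelling  lab : A → B → L  into an ordered set of
-- labels (L, _≼_).

module BiClique {A B L : Set} (_≼_ : L → L → Set) (lab : A → B → L) where

  Vertex : Set
  Vertex = A ⊎ B

  Edge : Set
  Edge = A × B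

  label : Edge → L
  label (a , b) = lab a b

  data Step : Vertex → Vertex → Edge → Set where
    ab : ∀ x y → Step (inj₁ x) (inj₂ y) (x , y)
    ba : ∀ x y → Step (inj₂ y) (inj₁ x) (x , y)

  data Walk : Vertex → Vertex → List Vertex → List Edge → Set where
    stop : ∀ v → Walk v v [ v ] []
    step : ∀ {u w v e vs es} → Step u w e → Walk w v vs es →
           Walk u v (u ∷ vs) (e ∷ es)

  TemporalPath : List Edge → A → B → Set
  TemporalPath S a b =
    ∃[ vs ] ∃[ es ] ( Walk (inj₁ a) (inj₂ b) vs es
                    × Unique vs
                    × All (_∈ S) es
                    × Linked (λ e e′ → label e ≼ label e′) es )

  BiSpanner : List Edge → Set
  BiSpanner S = ∀ a b → TemporalPath S a b

_≤lex_ : ℕ × ℕ → ℕ × ℕ → Set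
(x₁ , y₁) ≤lex (x₂ , y₂) = (x₁ < x₂) ⊎ ((x₁ ≡ x₂) × (y₁ ≤ y₂))

prodLab : {AG BG AH BH : Set} → (AG → BG → ℕ) → (AH → BH → ℕ) →
          AG × AH → BG × BH → ℕ × ℕ
prodLab λG λH (aG , aH) (bG , bH) = (λG aG bG , λH aH bH)

-- From (aG , aH), first follow a temporal path aH ⇝ bH of H inside the copy of SH
-- attached to aG: its edges join (aG , ·) to (τ aG , ·), where (aG , τ aG) is the
-- earliest SG-edge at aG, so their first coordinate c = λG(aG , τ aG) is constant.
-- Arriving at (τ aG , bH), cross to (aG , ρ bH) along an edge of the copy of SG
-- attached to bH, where (ρ bH , bH) is the latest edge into bH, so its label (c , M)
-- dominates everything so far.  Finally follow a temporal path aG ⇝ bG of G inside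
-- that copy, whose second coordinate is constantly M and whose first label is at
-- least c by the choice of τ.  Erasing loops turns this temporal walk into a path.
-- There are nG copies of SH and nH copies of SG.
module Submission where

open import Defs
open import Data.Nat using (ℕ; _≤_; _<_; _+_; _*_)
open import Data.Nat.Properties
  using (≤-refl; ≤-trans; <-trans; ≤-reflexive; *-comm; m≤n⇒m<n∨m≡n)
open import Data.Fin using (Fin)
import Data.Fin as Fin
open import Data.Product using (_×_; _,_; proj₁; proj₂; Σ; ∃-syntax)
open import Data.Product.Properties using () renaming (≡-dec to ×-≡-dec)
open import Data.Product.Relation.Binary.Lex.Strict using (×-transitive)
open import Data.Sum using (_⊎_; inj₁; inj₂; map₂)
import Data.Sum as Sum
open import Data.Sum.Properties using () renaming (≡-dec to ⊎-≡-dec)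
open import Data.List
  using (List; []; _∷_; [_]; _++_; length; map; filter; allFin; cartesianProductWith)
open import Data.List.Properties using (length-++; length-map; length-tabulate)
open import Data.List.Membership.Propositional using (_∈_)
open import Data.List.Membership.Propositional.Properties
  using (∈-map⁺; ∈-map⁻; ∈-filter⁺; ∈-filter⁻; ∈-allFin; ∈-++⁺ˡ; ∈-++⁺ʳ; ∈-cartesianProductWith⁺)
import Data.List.Membership.DecPropositional as DecMembership
open import Data.List.Relation.Unary.Any using (here; there)
open import Data.List.Relation.Unary.All using (All; []; _∷_; lookup)
open import Data.List.Relation.Unary.All.Properties using (¬Any⇒All¬)
open import Data.List.Relation.Unary.Linked using (Linked; []; [-]; _∷_)
open import Data.List.Relation.Unary.AllPairs using ([]; _∷_)
open import Data.List.Relation.Unary.Unique.Propositional using (Unique)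
open import Data.List.Extrema.Nat using (argmin; argmax; argmin-sel; f[argmin]≤f[xs]; f[xs]≤f[argmax])
open import Relation.Binary.Definitions using (Reflexive; Transitive; DecidableEquality)
open import Relation.Binary.PropositionalEquality
  using (_≡_; refl; sym; cong; cong₂; subst; isEquivalence; resp₂; module ≡-Reasoning)
open import Relation.Nullary using (yes; no)

length-cartesianProductWith : {X Y Z : Set} (f : X → Y → Z) (xs : List X) (ys : List Y) →
                              length (cartesianProductWith f xs ys) ≡ length xs * length ys
length-cartesianProductWith f []       ys = refl
length-cartesianProductWith f (x ∷ xs) ys = begin
  length (map (f x) ys ++ cartesianProductWith f xs ys)           ≡⟨ length-++ (map (f x) ys) ⟩
  length (map (f x) ys) + length (cartesianProductWith f xs ys)   ≡⟨ cong₂ _+_ (length-map (f x) ys)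
                                                                            (length-cartesianProductWith f xs ys) ⟩
  length ys + length xs * length ys                               ∎
  where open ≡-Reasoning

length-allFin : ∀ n → length (allFin n) ≡ n
length-allFin n = length-tabulate (λ i → i)

module Journeys {A B L : Set} (_≼_ : L → L → Set) (lab : A → B → L) (S : List (A × B)) where
  open BiClique _≼_ lab

  -- Journey u s v t: leave u no earlier than time s, reach v by time t,
  -- along edges of S with non-decreasing labels.
  data Journey : Vertex → L → Vertex → L → Set where
    arrive : ∀ {v s t} → s ≼ t → Journey v s v t
    hop    : ∀ {u w v e s t} → Step u w e → e ∈ S → s ≼ label e →
             Journey w (label e) v t → Journey u s v t

  vertices : ∀ {u s v t} → Journey u s v t → List Vertex
  vertices {v = v} (arrive _)    = [ v ]
  vertices {u = u} (hop _ _ _ j) = u ∷ vertices j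

  edges : ∀ {u s v t} → Journey u s v t → List Edge
  edges (arrive _)            = []
  edges (hop {e = e} _ _ _ j) = e ∷ edges j

  walk : ∀ {u s v t} (j : Journey u s v t) → Walk u v (vertices j) (edges j)
  walk {v = v} (arrive _)  = stop v
  walk (hop st _ _ j)      = step st (walk j)

  edges-in-S : ∀ {u s v t} (j : Journey u s v t) → All (_∈ S) (edges j)
  edges-in-S (arrive _)     = []
  edges-in-S (hop _ e∈S _ j) = e∈S ∷ edges-in-S j

  edges-nondecreasing : ∀ {u s v t} (j : Journey u s v t) →
                        Linked (λ e e′ → label e ≼ label e′) (edges j)
  edges-nondecreasing (arrive _)            = []
  edges-nondecreasing (hop {e = e} _ _ _ j) = after e j
    where
    after : ∀ {w v t} e (j : Journey w (label e) v t) →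
            Linked (λ e e′ → label e ≼ label e′) (e ∷ edges j)
    after e (arrive _)             = [-]
    after e (hop {e = e′} _ _ p j) = p ∷ after e′ j

  module Properties (≼-refl : Reflexive _≼_) (≼-trans : Transitive _≼_) where

    delay : ∀ {u r s v t} → r ≼ s → Journey u s v t → Journey u r v t
    delay p (arrive q)      = arrive (≼-trans p q)
    delay p (hop st m q j)  = hop st m (≼-trans p q) j

    infixr 5 _++ʲ_
    _++ʲ_ : ∀ {u r w s v t} → Journey u r w s → Journey w s v t → Journey u r v t
    arrive p       ++ʲ k = delay p k
    hop st m p j   ++ʲ k = hop st m p (j ++ʲ k)

    walk⇒journey : ∀ {u b vs e es} → Walk u (inj₂ b) vs (e ∷ es) → All (_∈ S) (e ∷ es) →
                   Linked (λ e e′ → label e ≼ label e′) (e ∷ es) →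
                   ∃[ x ] Journey u (label e) (inj₂ b) (lab x b)
    walk⇒journey (step st@(ab x _) (stop _)) (e∈S ∷ []) _ = x , hop st e∈S ≼-refl (arrive ≼-refl)
    walk⇒journey (step st w@(step _ _)) (e∈S ∷ es∈S) (p ∷ nondecr) with walk⇒journey w es∈S nondecr
    ... | x , j = x , hop st e∈S ≼-refl (delay p j)

    temporalPath⇒journey : ∀ {a b} → TemporalPath S a b →
                           ∃[ y ] ∃[ x ] ((a , y) ∈ S × Journey (inj₁ a) (lab a y) (inj₂ b) (lab x b))
    temporalPath⇒journey (_ , _ , w@(step (ab _ y) _) , _ , es∈S@(e∈S ∷ _) , nondecr)
      with walk⇒journey w es∈S nondecr
    ... | x , j = y , x , e∈S , j

    module _ (_≟_ : DecidableEquality Vertex) where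
      open DecMembership _≟_ using (_∈?_)

      SimpleJourney : Vertex → L → Vertex → L → Set
      SimpleJourney u s v t = Σ (Journey u s v t) (λ j → Unique (vertices j))

      delay-simple : ∀ {u r s v t} → r ≼ s → SimpleJourney u s v t → SimpleJourney u r v t
      delay-simple {u} {r} {s} {v} {t} p (j , uniq) = delay p j , unique-delay j uniq
        where
        unique-delay : (j : Journey u s v t) → Unique (vertices j) → Unique (vertices (delay p j))
        unique-delay (arrive _)    uniq = uniq
        unique-delay (hop _ _ _ _) uniq = uniq

      suffixFrom : ∀ {u w s v t} (j : Journey w s v t) → Unique (vertices j) →
                   u ∈ vertices j → SimpleJourney u s v t
      suffixFrom (arrive p)           uniq       (here refl) = arrive p , uniq
      suffixFrom j@(hop _ _ _ _)      uniq       (here refl) = j , uniq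
      suffixFrom (hop _ _ p j)        (_ ∷ uniq) (there i)   = delay-simple p (suffixFrom j uniq i)

      -- Loop erasure: if u recurs in the erased tail, restart from that occurrence;
      -- departing from u later is still a journey from time s.
      erase : ∀ {u s v t} → Journey u s v t → SimpleJourney u s v t
      erase (arrive p) = arrive p , [] ∷ []
      erase {u = u} (hop st m p j) with erase j
      ... | j′ , uniq′ with u ∈? vertices j′
      ...   | yes i  = delay-simple p (suffixFrom j′ uniq′ i)
      ...   | no u∉  = hop st m p j′ , ¬Any⇒All¬ (vertices j′) u∉ ∷ uniq′

      journey⇒temporalPath : ∀ {a s b t} → Journey (inj₁ a) s (inj₂ b) t → TemporalPath S a b
      journey⇒temporalPath j with erase j
      ... | j′ , uniq = vertices j′ , edges j′ , walk j′ , uniq , edges-in-S j′ , edges-nondecreasing j′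

module JourneyMap {A B L A′ B′ L′ : Set}
    {_≼_ : L → L → Set} {lab : A → B → L} {S : List (A × B)}
    {_≼′_ : L′ → L′ → Set} {lab′ : A′ → B′ → L′} {S′ : List (A′ × B′)}
    (fA : A → A′) (fB : B → B′) (f : L → L′)
    (f-mono : ∀ {s t} → s ≼ t → f s ≼′ f t)
    (f-lab : ∀ a b → lab′ (fA a) (fB b) ≡ f (lab a b))
    (f-S : ∀ {a b} → (a , b) ∈ S → (fA a , fB b) ∈ S′) where
  open BiClique using (ab; ba)
  module J  = Journeys _≼_ lab S
  module J′ = Journeys _≼′_ lab′ S′

  mapVertex : A ⊎ B → A′ ⊎ B′
  mapVertex = Sum.map fA fB

  mapStep : ∀ {u w x y} → BiClique.Step _≼_ lab u w (x , y) →
            BiClique.Step _≼′_ lab′ (mapVertex u) (mapVertex w) (fA x , fB y)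
  mapStep (ab x y) = ab (fA x) (fB y)
  mapStep (ba x y) = ba (fA x) (fB y)

  mapJourney : ∀ {u s v t} → J.Journey u s v t → J′.Journey (mapVertex u) (f s) (mapVertex v) (f t)
  mapJourney (J.arrive p) = J′.arrive (f-mono p)
  mapJourney {s = s} (J.hop {e = x , y} st e∈S p j) =
    J′.hop (mapStep st) (f-S e∈S) (subst (f s ≼′_) label≡ (f-mono p))
           (subst (λ l → J′.Journey _ l _ _) label≡ (mapJourney j))
    where
    label≡ : f (lab x y) ≡ lab′ (fA x) (fB y)
    label≡ = sym (f-lab x y)

module _ {A B : Set} (_≟_ : DecidableEquality A) (lab : A → B → ℕ) where

  outNeighbours : List (A × B) → A → List B
  outNeighbours S a = map proj₂ (filter (λ e → proj₁ e ≟ a) S)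

  ∈-outNeighbours⁺ : ∀ {S a y} → (a , y) ∈ S → y ∈ outNeighbours S a
  ∈-outNeighbours⁺ {S} {a} e∈S = ∈-map⁺ proj₂ (∈-filter⁺ (λ e → proj₁ e ≟ a) e∈S refl)

  ∈-outNeighbours⁻ : ∀ {S a y} → y ∈ outNeighbours S a → (a , y) ∈ S
  ∈-outNeighbours⁻ {S} {a} y∈ with ∈-map⁻ proj₂ y∈
  ... | _ , e∈filter , refl with ∈-filter⁻ (λ e → proj₁ e ≟ a) {xs = S} e∈filter
  ...   | e∈S , refl = e∈S

  earliestEdge : ∀ S a {y₀} → (a , y₀) ∈ S →
                 ∃[ y ] ((a , y) ∈ S × (∀ {y′} → (a , y′) ∈ S → lab a y ≤ lab a y′))
  earliestEdge S a {y₀} e₀∈S = y , y∈S , earliest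
    where
    y : B
    y = argmin (lab a) y₀ (outNeighbours S a)
    y∈S : (a , y) ∈ S
    y∈S with argmin-sel (lab a) y₀ (outNeighbours S a)
    ... | inj₁ y≡y₀ = subst (λ z → (a , z) ∈ S) (sym y≡y₀) e₀∈S
    ... | inj₂ y∈   = ∈-outNeighbours⁻ y∈
    earliest : ∀ {y′} → (a , y′) ∈ S → lab a y ≤ lab a y′
    earliest e∈S = lookup (f[argmin]≤f[xs] y₀ (outNeighbours S a)) (∈-outNeighbours⁺ e∈S)

≤lex-refl : Reflexive _≤lex_
≤lex-refl = inj₂ (refl , ≤-refl)

≤lex-trans : Transitive _≤lex_
≤lex-trans = ×-transitive {_≈₁_ = _≡_} {_<₁_ = _<_} {_<₂_ = _≤_} isEquivalence (resp₂ _<_) <-trans ≤-trans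

≤⇒≤lex-fst : ∀ {m n k} → m ≤ n → (m , k) ≤lex (n , k)
≤⇒≤lex-fst m≤n = map₂ (_, ≤-refl) (m≤n⇒m<n∨m≡n m≤n)

≤⇒≤lex-snd : ∀ {k m n} → m ≤ n → (k , m) ≤lex (k , n)
≤⇒≤lex-snd m≤n = inj₂ (refl , m≤n)

module ProductSpanner (nG nH : ℕ) (λG : Fin nG → Fin nG → ℕ) (λH : Fin nH → Fin nH → ℕ)
    (SG : List (Fin nG × Fin nG)) (SH : List (Fin nH × Fin nH))
    (SG-spanner : BiClique.BiSpanner _≤_ λG SG) (SH-spanner : BiClique.BiSpanner _≤_ λH SH) where

  module G = Journeys _≤_ λG SG
  module H = Journeys _≤_ λH SH
  open G.Properties ≤-refl ≤-trans using () renaming (temporalPath⇒journey to G-journey)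
  open H.Properties ≤-refl ≤-trans using () renaming (temporalPath⇒journey to H-journey)

  Edge : Set
  Edge = (Fin nG × Fin nH) × (Fin nG × Fin nH)

  -- Both parts of G and of H are Fin n, so a vertex of one part also names one of the other:
  -- SG-spanner a a yields an SG-edge at a, and b is a default for the argmax.
  earliestEdgeG : ∀ a → ∃[ y ] ((a , y) ∈ SG × (∀ {y′} → (a , y′) ∈ SG → λG a y ≤ λG a y′))
  earliestEdgeG a = earliestEdge Fin._≟_ λG SG a (G-journey (SG-spanner a a) .proj₂ .proj₂ .proj₁)

  earliestG : Fin nG → Fin nG
  earliestG a = earliestEdgeG a .proj₁

  earliestG∈SG : ∀ a → (a , earliestG a) ∈ SG
  earliestG∈SG a = earliestEdgeG a .proj₂ .proj₁

  earliestG-earliest : ∀ {a y} → (a , y) ∈ SG → λG a (earliestG a) ≤ λG a y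
  earliestG-earliest {a} = earliestEdgeG a .proj₂ .proj₂

  latestH : Fin nH → Fin nH
  latestH b = argmax (λ x → λH x b) b (allFin nH)

  latestH-latest : ∀ b x → λH x b ≤ λH (latestH b) b
  latestH-latest b x = lookup (f[xs]≤f[argmax] b (allFin nH)) (∈-allFin x)

  copyOfG : Fin nH → Fin nG × Fin nG → Edge
  copyOfG b (x , y) = (x , latestH b) , (y , b)

  copyOfH : Fin nG → Fin nH × Fin nH → Edge
  copyOfH a (x , y) = (a , x) , (earliestG a , y)

  S : List Edge
  S = cartesianProductWith copyOfG (allFin nH) SG ++ cartesianProductWith copyOfH (allFin nG) SH

  copyOfG∈S : ∀ b {e} → e ∈ SG → copyOfG b e ∈ S
  copyOfG∈S b e∈SG = ∈-++⁺ˡ (∈-cartesianProductWith⁺ copyOfG (∈-allFin b) e∈SG)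

  copyOfH∈S : ∀ a {e} → e ∈ SH → copyOfH a e ∈ S
  copyOfH∈S a e∈SH = ∈-++⁺ʳ (cartesianProductWith copyOfG (allFin nH) SG)
                             (∈-cartesianProductWith⁺ copyOfH (∈-allFin a) e∈SH)

  length-S : length S ≡ length SG * nH + length SH * nG
  length-S = begin
    length S
      ≡⟨ length-++ (cartesianProductWith copyOfG (allFin nH) SG) ⟩
    length (cartesianProductWith copyOfG (allFin nH) SG) + length (cartesianProductWith copyOfH (allFin nG) SH)
      ≡⟨ cong₂ _+_ (length-cartesianProductWith copyOfG (allFin nH) SG)
                   (length-cartesianProductWith copyOfH (allFin nG) SH) ⟩
    length (allFin nH) * length SG + length (allFin nG) * length SH
      ≡⟨ cong₂ _+_ (cong (_* length SG) (length-allFin nH)) (cong (_* length SH) (length-allFin nG)) ⟩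
    nH * length SG + nG * length SH
      ≡⟨ cong₂ _+_ (*-comm nH (length SG)) (*-comm nG (length SH)) ⟩
    length SG * nH + length SH * nG
      ∎
    where open ≡-Reasoning

  module P = Journeys _≤lex_ (prodLab λG λH) S
  open P using (arrive; hop)
  open P.Properties ≤lex-refl ≤lex-trans

  _≟V_ : DecidableEquality ((Fin nG × Fin nH) ⊎ (Fin nG × Fin nH))
  _≟V_ = ⊎-≡-dec (×-≡-dec Fin._≟_ Fin._≟_) (×-≡-dec Fin._≟_ Fin._≟_)

  module InCopyOfG (b : Fin nH) =
    JourneyMap {lab = λG} {S = SG} {_≼′_ = _≤lex_} {lab′ = prodLab λG λH} {S′ = S}
      (_, latestH b) (_, b) (_, λH (latestH b) b) ≤⇒≤lex-fst (λ _ _ → refl) (copyOfG∈S b)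

  module InCopyOfH (a : Fin nG) =
    JourneyMap {lab = λH} {S = SH} {_≼′_ = _≤lex_} {lab′ = prodLab λG λH} {S′ = S}
      (a ,_) (earliestG a ,_) (λG a (earliestG a) ,_) ≤⇒≤lex-snd (λ _ _ → refl) (copyOfH∈S a)

  spanner : BiClique.BiSpanner _≤lex_ (prodLab λG λH) S
  spanner (aG , aH) (bG , bH) with H-journey (SH-spanner aH bH) | G-journey (SG-spanner aG bG)
  ... | yH , xH , _ , jH | yG , xG , aGyG∈SG , jG =
    journey⇒temporalPath _≟V_ (inCopyOfH ++ʲ bridge ++ʲ inCopyOfG)
    where
    c M : ℕ
    c = λG aG (earliestG aG)
    M = λH (latestH bH) bH

    inCopyOfH : P.Journey (inj₁ (aG , aH)) (c , λH aH yH) (inj₂ (earliestG aG , bH)) (c , λH xH bH)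
    inCopyOfH = InCopyOfH.mapJourney aG jH

    bridge : P.Journey (inj₂ (earliestG aG , bH)) (c , λH xH bH) (inj₁ (aG , latestH bH)) (c , M)
    bridge = hop (BiClique.ba (aG , latestH bH) (earliestG aG , bH)) (copyOfG∈S bH (earliestG∈SG aG))
                 (≤⇒≤lex-snd (latestH-latest bH xH)) (arrive ≤lex-refl)

    inCopyOfG : P.Journey (inj₁ (aG , latestH bH)) (c , M) (inj₂ (bG , bH)) (λG xG bG , M)
    inCopyOfG = delay (≤⇒≤lex-fst (earliestG-earliest aGyG∈SG)) (InCopyOfG.mapJourney bH jG)

lemma46 : (nG nH : ℕ)
    (λG : Fin nG → Fin nG → ℕ) (λH : Fin nH → Fin nH → ℕ)
    (SG : List (Fin nG × Fin nG)) (SH : List (Fin nH × Fin nH)) →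
    Unique SG → Unique SH →
    BiClique.BiSpanner _≤_ λG SG → BiClique.BiSpanner _≤_ λH SH →
    ∃[ S ] ( BiClique.BiSpanner _≤lex_ (prodLab λG λH) S
    × length S ≤ length SG * nH + length SH * nG )
lemma46 nG nH λG λH SG SH _ _ SG-spanner SH-spanner = S , spanner , ≤-reflexive length-S
  where open ProductSpanner nG nH λG λH SG SH SG-spanner SH-spanner
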